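{- Let $k,n\in\mathbb{N}$ and $w\in\{0,1\}^{k+n}$ be such that $w_{[0,n)}=w_{[k,k+n)}$ and there exists $i<k$ with $\xi(w_{[i,i+n)})=1$. Then there exists $j<k$ with $\xi(w_{[j,j+n)})=-1$.
   Context: For a string $w=w_0\dots w_{\#w-1}$, $w_{[a,b)}=w_a\dots w_{b-1}$; $\#w$ is the length and $\varepsilon$ the empty string. For $\#w\ge1$, $l(w)$ is $w$ without its last letter and $r(w)$ is $w$ without its first letter. $T^n$ is the alternating string of length $n$ starting with $0$ ($T^0=\varepsilon$, $T^n=T^{n-1}0$ for odd $n$, $T^n=T^{n-1}1$ for even $n\ge2$) and $CT^n$ its letterwise complement. $\xi:\{0,1\}^*\to\{ -1,0,1\}$: $\xi(\varepsilon)=0$; $\xi(w)=1$ if $w=T^k$, $k\ge2$ even; $\xi(w)=-1$ if $w=CT^k$, $k\ge2$ even; otherwise $\xi(w)=\operatorname{sgn}(\xi(l(w))+\xi(r(w)))$. -}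

module Defs where

open import Data.Bool using (Bool; true; false; not; if_then_else_)
open import Data.Bool.Properties using () renaming (_≟_ to _≟𝔹_)
open import Data.Nat using (ℕ; zero; suc; _+_; _<_; _%_)
open import Data.Nat.Properties using (+-mono-<; m≤n+m; ≤-trans)
open import Data.Fin using (Fin; toℕ; fromℕ<; _↑ʳ_)
open import Data.Fin.Properties using (toℕ<n)
open import Data.Integer using (ℤ; +_; -[1+_]; 0ℤ; 1ℤ; -1ℤ)
  renaming (_+_ to _+ℤ_)
open import Data.Vec using (Vec; []; _∷_; tabulate; map; init; tail; lookup)
open import Data.Vec.Properties using (≡-dec)
open import Relation.Nullary using (Dec; yes; no)
open import Relation.Binary.PropositionalEquality using (_≡_)

-- Letters: 0 is false, 1 is true.

T : (n : ℕ) → Vec Bool n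
T n = tabulate (λ i → parity (toℕ i))
  where
  parity : ℕ → Bool
  parity zero = false
  parity (suc m) = not (parity m)

CT : (n : ℕ) → Vec Bool n
CT n = map not (T n)

sgn : ℤ → ℤ
sgn (+ zero) = 0ℤ
sgn (+ suc _) = 1ℤ
sgn -[1+ _ ] = -1ℤ

evenPos : ℕ → Bool
evenPos zero = false
evenPos (suc zero) = false
evenPos (suc (suc zero)) = true
evenPos (suc (suc (suc m))) = evenPos (suc m)

-- ξ, by recursion on the length.
-- For length ≥ 1, l(w) = init w and r(w) = tail w.
ξ : {m : ℕ} → Vec Bool m → ℤ
ξ {zero} [] = 0ℤ
ξ {suc m} w with evenPos (suc m) | ≡-dec _≟𝔹_ w (T (suc m)) | ≡-dec _≟𝔹_ w (CT (suc m))
... | true | yes _ | _ = 1ℤ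
... | true | no _ | yes _ = -1ℤ
... | _ | _ | _ = sgn (ξ (init w) +ℤ ξ (tail w))

slice : {k n : ℕ} → Vec Bool (k + n) → Fin k → Vec Bool n
slice {k} {n} w i = tabulate (λ t → lookup w (fromℕ< (+-mono-< (toℕ<n i) (toℕ<n t))))

prefix : {k n : ℕ} → Vec Bool (k + n) → Vec Bool n
prefix {k} {n} w = tabulate (λ t → lookup w (fromℕ< (≤-trans (toℕ<n t) (m≤n+m n k))))

suffix : {k n : ℕ} → Vec Bool (k + n) → Vec Bool n
suffix {k} {n} w = tabulate (λ t → lookup w (k ↑ʳ t))

-- Extend w to its K-periodic continuation g : ℕ → Bool, so that the windows
-- w_[i,i+n) are the length-n windows of g.  If g contains a factor 1?0 at q,
-- shift it to the centre of a window: ξ of a word whose centre is 1?0 (odd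
-- length) or 10 inside 110 / 100 (even length) is −1, since by induction on q
-- the value −1 of the central word spreads outward through the recursion.
-- Otherwise g x = 1 forces g (x + 2) = 1, and together with periodicity this
-- makes g 2-periodic, i.e. constant (every ξ vanishes) or alternating; then the
-- window with ξ = 1 is T^n and the window one step to the right is CT^n.
module Submission where

open import Defs
open import Data.Bool using (Bool; true; false; not; if_then_else_)
open import Data.Bool.Properties using (not-involutive; not-¬; ¬-not) renaming (_≟_ to _≟𝔹_)
open import Data.Nat using (ℕ; zero; suc; _+_; _*_; _<_; _≤_; s≤s; z≤n; _%_; _/_; NonZero)
open import Data.Nat.Properties
  using (m≤n⇒m≤1+n; m≤n⇒m≤o+n; m≤n+m; ≤-trans; +-assoc; +-suc; +-comm; +-cancelˡ-<; +-mono-<)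
open import Data.Nat.DivMod using (m≡m%n+[m/n]*n; [m+n]%n≡m%n; m%n<n)
open import Data.Nat.Tactic.RingSolver using (solve-∀)
open import Data.Fin using (Fin; zero; suc; toℕ; fromℕ<; _↑ʳ_)
open import Data.Fin.Properties using (any?; toℕ-fromℕ<; toℕ-↑ʳ; toℕ<n)
open import Data.Integer using (ℤ; +_; -[1+_]; 0ℤ; 1ℤ; -1ℤ) renaming (_+_ to _+ℤ_)
open import Data.Vec using (Vec; []; _∷_; tabulate; init; tail; lookup)
open import Data.Vec.Properties using (≡-dec; tabulate-∘; tabulate-cong; ∷-injective; lookup∘tabulate)
open import Data.Product using (_×_; _,_; proj₁; proj₂; ∃)
open import Data.Sum using (_⊎_; inj₁; inj₂)
open import Data.Empty using (⊥-elim)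
open import Function using (_∘_)
open import Relation.Nullary using (yes; no)
open import Relation.Nullary.Decidable using (_×-dec_)
open import Relation.Binary.PropositionalEquality

private variable
  m : ℕ
  x y : ℤ

ξ-lr : Vec Bool (suc m) → ℤ
ξ-lr v = sgn (ξ (init v) +ℤ ξ (tail v))

ξ-odd : (v : Vec Bool (suc m)) → evenPos (suc m) ≡ false → ξ v ≡ ξ-lr v
ξ-odd {m} v odd with evenPos (suc m)
... | false = refl

ξ-≡T : (v : Vec Bool (suc m)) → evenPos (suc m) ≡ true → v ≡ T (suc m) → ξ v ≡ 1ℤ
ξ-≡T {m} v even v≡T with evenPos (suc m) | ≡-dec _≟𝔹_ v (T (suc m))
... | true | yes _ = refl
... | true | no v≢T = ⊥-elim (v≢T v≡T)

ξ-≡CT : (v : Vec Bool (suc m)) → evenPos (suc m) ≡ true → v ≢ T (suc m) → v ≡ CT (suc m) → ξ v ≡ -1ℤ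
ξ-≡CT {m} v even v≢T v≡CT with evenPos (suc m) | ≡-dec _≟𝔹_ v (T (suc m)) | ≡-dec _≟𝔹_ v (CT (suc m))
... | true | yes v≡T | _ = ⊥-elim (v≢T v≡T)
... | true | no _ | yes _ = refl
... | true | no _ | no v≢CT = ⊥-elim (v≢CT v≡CT)

ξ-≢T : (v : Vec Bool (suc m)) → v ≢ T (suc m) → ξ v ≡ -1ℤ ⊎ ξ v ≡ ξ-lr v
ξ-≢T {m} v v≢T with evenPos (suc m) | ≡-dec _≟𝔹_ v (T (suc m)) | ≡-dec _≟𝔹_ v (CT (suc m))
... | true | yes v≡T | _ = ⊥-elim (v≢T v≡T)
... | true | no _ | yes _ = inj₁ refl
... | true | no _ | no _ = inj₂ refl
... | false | _ | _ = inj₂ refl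

ξ-≢T-≢CT : (v : Vec Bool (suc m)) → v ≢ T (suc m) → v ≢ CT (suc m) → ξ v ≡ ξ-lr v
ξ-≢T-≢CT {m} v v≢T v≢CT with evenPos (suc m) | ≡-dec _≟𝔹_ v (T (suc m)) | ≡-dec _≟𝔹_ v (CT (suc m))
... | true | yes v≡T | _ = ⊥-elim (v≢T v≡T)
... | true | no _ | yes v≡CT = ⊥-elim (v≢CT v≡CT)
... | true | no _ | no _ = refl
... | false | _ | _ = refl

data IsSign : ℤ → Set where
  negative : IsSign -1ℤ
  zero     : IsSign 0ℤ
  positive : IsSign 1ℤ

sgn-isSign : ∀ z → IsSign (sgn z)
sgn-isSign (+ zero)  = zero
sgn-isSign (+ suc _) = positive
sgn-isSign -[1+ _ ]  = negative

ξ-isSign : (v : Vec Bool m) → IsSign (ξ v)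
ξ-isSign {zero} [] = zero
ξ-isSign {suc m} v with evenPos (suc m) | ≡-dec _≟𝔹_ v (T (suc m)) | ≡-dec _≟𝔹_ v (CT (suc m))
... | true | yes _ | _ = positive
... | true | no _ | yes _ = negative
... | true | no _ | no _ = sgn-isSign _
... | false | _ | _ = sgn-isSign _

0≢1 : 0ℤ ≢ 1ℤ
0≢1 ()

sgn-neg+nonpos : x ≡ -1ℤ → IsSign y → y ≢ 1ℤ → sgn (x +ℤ y) ≡ -1ℤ
sgn-neg+nonpos refl negative _ = refl
sgn-neg+nonpos refl zero _ = refl
sgn-neg+nonpos refl positive y≢1 = ⊥-elim (y≢1 refl)

sgn-nonpos+neg : IsSign x → x ≢ 1ℤ → y ≡ -1ℤ → sgn (x +ℤ y) ≡ -1ℤ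
sgn-nonpos+neg negative _ refl = refl
sgn-nonpos+neg zero _ refl = refl
sgn-nonpos+neg positive x≢1 refl = ⊥-elim (x≢1 refl)

sgn-neg+sign≢1 : x ≡ -1ℤ → IsSign y → sgn (x +ℤ y) ≢ 1ℤ
sgn-neg+sign≢1 refl negative ()
sgn-neg+sign≢1 refl zero ()
sgn-neg+sign≢1 refl positive ()

sgn-sign+neg≢1 : IsSign x → y ≡ -1ℤ → sgn (x +ℤ y) ≢ 1ℤ
sgn-sign+neg≢1 negative refl ()
sgn-sign+neg≢1 zero refl ()
sgn-sign+neg≢1 positive refl ()

alt : Bool → (m : ℕ) → Vec Bool m
alt false = T
alt true = CT

alt-suc : ∀ b m → alt b (suc m) ≡ b ∷ alt (not b) m
alt-suc false m = cong (false ∷_) (tabulate-∘ not _)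
alt-suc true m = cong (true ∷_) (trans (sym (tabulate-∘ not _)) (tabulate-cong (λ _ → not-involutive _)))

double : ℕ → ℕ
double zero = zero
double (suc p) = suc (suc (double p))

≤-double : ∀ p → p ≤ double p
≤-double zero = z≤n
≤-double (suc p) = s≤s (m≤n⇒m≤1+n (≤-double p))

double≡+ : ∀ k → double k ≡ k + k
double≡+ zero = refl
double≡+ (suc k) = cong suc (trans (cong suc (double≡+ k)) (sym (+-suc k k)))

data Parity : ℕ → Set where
  even : ∀ p → Parity (double p)
  odd  : ∀ p → Parity (suc (double p))

parity : ∀ m → Parity m
parity zero = even zero
parity (suc m) with parity m
... | even p = odd p
... | odd p = even (suc p)

evenPos-odd : ∀ p → evenPos (suc (double p)) ≡ false
evenPos-odd zero = refl
evenPos-odd (suc zero) = refl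
evenPos-odd (suc (suc p)) = evenPos-odd (suc p)

evenPos-even : ∀ p → evenPos (double (suc p)) ≡ true
evenPos-even zero = refl
evenPos-even (suc p) = evenPos-even p

ξ-alt-even : ∀ b p → ξ (alt b (double (suc p))) ≡ (if b then -1ℤ else 1ℤ)
ξ-alt-even false p = ξ-≡T (T (double (suc p))) (evenPos-even p) refl
ξ-alt-even true p = ξ-≡CT (CT (double (suc p))) (evenPos-even p) CT≢T refl
  where
  CT≢T : CT (double (suc p)) ≢ T (double (suc p))
  CT≢T CT≡T with trans (sym (alt-suc true _)) (trans CT≡T (alt-suc false _))
  ... | ()

take : (m : ℕ) → (ℕ → Bool) → Vec Bool m
take m g = tabulate (g ∘ toℕ)

drop : ℕ → (ℕ → Bool) → ℕ → Bool
drop s g t = g (s + t)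

init-take : ∀ m g → init (take (suc m) g) ≡ take m g
init-take zero g = refl
init-take (suc m) g = cong (g 0 ∷_) (init-take m (g ∘ suc))

ξ-lr-take : ∀ m g → ξ-lr (take (suc m) g) ≡ sgn (ξ (take m g) +ℤ ξ (take m (g ∘ suc)))
ξ-lr-take m g = cong (λ v → sgn (ξ v +ℤ ξ (take m (g ∘ suc)))) (init-take m g)

take-≢alt : ∀ a b g → suc a < m → g a ≡ g (suc a) → take m g ≢ alt b m
take-≢alt {suc (suc m)} zero b g _ g₀≡g₁ take≡alt =
  not-¬ refl (trans (sym (proj₁ (∷-injective cons≡))) (trans g₀≡g₁ (proj₁ (∷-injective tail≡))))
  where
  cons≡ = trans take≡alt (alt-suc b (suc m))
  tail≡ = trans (proj₂ (∷-injective cons≡)) (alt-suc (not b) m)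
take-≢alt {suc m} (suc a) b g (s≤s a<m) gₐ≡gₐ₊₁ take≡alt =
  take-≢alt a (not b) (g ∘ suc) a<m gₐ≡gₐ₊₁ (proj₂ (∷-injective (trans take≡alt (alt-suc b m))))

ξ-take-odd : ∀ p g → ξ (take (suc (double p)) g) ≡ sgn (ξ (take (double p) g) +ℤ ξ (take (double p) (g ∘ suc)))
ξ-take-odd p g = trans (ξ-odd (take (suc (double p)) g) (evenPos-odd p)) (ξ-lr-take (double p) g)

-- Two equal adjacent letters rule out T^m; the CT^m case gives −1, whence P -1ℤ.
ξ-take-even : ∀ {P : ℤ → Set} p a g → suc a < double (suc p) → g a ≡ g (suc a) → P -1ℤ →
  P (sgn (ξ (take (suc (double p)) g) +ℤ ξ (take (suc (double p)) (g ∘ suc)))) →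
  P (ξ (take (double (suc p)) g))
ξ-take-even {P} p a g a<len gₐ≡gₐ₊₁ P-1 P-lr with ξ-≢T (take (double (suc p)) g) (take-≢alt a false g a<len gₐ≡gₐ₊₁)
... | inj₁ ξ≡-1 = subst P (sym ξ≡-1) P-1
... | inj₂ ξ≡lr = subst P (sym (trans ξ≡lr (ξ-lr-take (suc (double p)) g))) P-lr

ξ-take-10 : ∀ g → g 0 ≡ true → g 1 ≡ false → ξ (take 2 g) ≡ -1ℤ
ξ-take-10 g g₀ g₁ rewrite g₀ | g₁ = refl

-- The factor 110 at q is the centre of the words of lengths 2q+3 and 2q+4.
ξ-take-110 : ∀ q g → g q ≡ true → g (suc q) ≡ true → g (suc (suc q)) ≡ false →
  ξ (take (3 + double q) g) ≡ -1ℤ × ξ (take (4 + double q) g) ≡ -1ℤ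
ξ-take-110 zero g g₀ g₁ g₂ rewrite g₀ | g₁ | g₂ with g 3
... | false = refl , refl
... | true = refl , refl
ξ-take-110 (suc q) g g₁ g₂ g₃ = ξ[5+2q]≡-1 , ξ[6+2q]≡-1
  where
  g' : ℕ → Bool
  g' = g ∘ suc
  ξ'[3+2q]≡-1 : ξ (take (3 + double q) g') ≡ -1ℤ
  ξ'[3+2q]≡-1 = proj₁ (ξ-take-110 q g' g₁ g₂ g₃)
  ξ'[4+2q]≡-1 : ξ (take (4 + double q) g') ≡ -1ℤ
  ξ'[4+2q]≡-1 = proj₂ (ξ-take-110 q g' g₁ g₂ g₃)
  repeat : g (suc q) ≡ g (suc (suc q))
  repeat = trans g₁ (sym g₂)
  ξ[4+2q]≢1 : ξ (take (4 + double q) g) ≢ 1ℤ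
  ξ[4+2q]≢1 = ξ-take-even {P = _≢ 1ℤ} (suc q) (suc q) g (s≤s (s≤s (s≤s (m≤n⇒m≤o+n 1 (≤-double q))))) repeat (λ ())
    (sgn-sign+neg≢1 (ξ-isSign (take (3 + double q) g)) ξ'[3+2q]≡-1)
  ξ[5+2q]≡-1 : ξ (take (5 + double q) g) ≡ -1ℤ
  ξ[5+2q]≡-1 = trans (ξ-take-odd (suc (suc q)) g)
    (sgn-nonpos+neg (ξ-isSign (take (4 + double q) g)) ξ[4+2q]≢1 ξ'[4+2q]≡-1)
  ξ'[5+2q]≢1 : ξ (take (5 + double q) g') ≢ 1ℤ
  ξ'[5+2q]≢1 ξ≡1 = sgn-neg+sign≢1 ξ'[4+2q]≡-1 (ξ-isSign (take (4 + double q) (g' ∘ suc)))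
    (trans (sym (ξ-take-odd (suc (suc q)) g')) ξ≡1)
  ξ[6+2q]≡-1 : ξ (take (6 + double q) g) ≡ -1ℤ
  ξ[6+2q]≡-1 = ξ-take-even {P = _≡ -1ℤ} (suc (suc q)) (suc q) g (s≤s (s≤s (s≤s (m≤n⇒m≤o+n 3 (≤-double q))))) repeat refl
    (sgn-neg+nonpos ξ[5+2q]≡-1 (ξ-isSign (take (5 + double q) g')) ξ'[5+2q]≢1)

-- The factor 100 at q is the centre of the words of lengths 2q+2 and 2q+3.
ξ-take-100 : ∀ q g → g q ≡ true → g (suc q) ≡ false → g (suc (suc q)) ≡ false →
  ξ (take (2 + double q) g) ≡ -1ℤ × ξ (take (3 + double q) g) ≡ -1ℤ
ξ-take-100 zero g g₀ g₁ g₂ rewrite g₀ | g₁ | g₂ = refl , refl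
ξ-take-100 (suc q) g g₁ g₂ g₃ = ξ[4+2q]≡-1 , ξ[5+2q]≡-1
  where
  g' : ℕ → Bool
  g' = g ∘ suc
  ξ'[2+2q]≡-1 : ξ (take (2 + double q) g') ≡ -1ℤ
  ξ'[2+2q]≡-1 = proj₁ (ξ-take-100 q g' g₁ g₂ g₃)
  ξ'[3+2q]≡-1 : ξ (take (3 + double q) g') ≡ -1ℤ
  ξ'[3+2q]≡-1 = proj₂ (ξ-take-100 q g' g₁ g₂ g₃)
  repeat : g (suc (suc q)) ≡ g (suc (suc (suc q)))
  repeat = trans g₂ (sym g₃)
  ξ[3+2q]≢1 : ξ (take (3 + double q) g) ≢ 1ℤ
  ξ[3+2q]≢1 ξ≡1 = sgn-sign+neg≢1 (ξ-isSign (take (2 + double q) g)) ξ'[2+2q]≡-1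
    (trans (sym (ξ-take-odd (suc q) g)) ξ≡1)
  ξ[4+2q]≡-1 : ξ (take (4 + double q) g) ≡ -1ℤ
  ξ[4+2q]≡-1 = ξ-take-even {P = _≡ -1ℤ} (suc q) (suc (suc q)) g (s≤s (s≤s (s≤s (s≤s (≤-double q))))) repeat refl
    (sgn-nonpos+neg (ξ-isSign (take (3 + double q) g)) ξ[3+2q]≢1 ξ'[3+2q]≡-1)
  ξ'[4+2q]≢1 : ξ (take (4 + double q) g') ≢ 1ℤ
  ξ'[4+2q]≢1 = ξ-take-even {P = _≢ 1ℤ} (suc q) (suc q) g' (s≤s (s≤s (s≤s (m≤n⇒m≤o+n 1 (≤-double q))))) repeat (λ ())
    (sgn-neg+sign≢1 ξ'[3+2q]≡-1 (ξ-isSign (take (3 + double q) (g' ∘ suc))))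
  ξ[5+2q]≡-1 : ξ (take (5 + double q) g) ≡ -1ℤ
  ξ[5+2q]≡-1 = trans (ξ-take-odd (suc (suc q)) g)
    (sgn-neg+nonpos ξ[4+2q]≡-1 (ξ-isSign (take (4 + double q) g')) ξ'[4+2q]≢1)

ξ-take-const : ∀ m b g → (∀ t → g t ≡ b) → ξ (take m g) ≡ 0ℤ
ξ-take-const zero b g _ = refl
ξ-take-const (suc zero) b g _ = refl
ξ-take-const (suc (suc m)) b g const = begin
  ξ (take (2 + m) g)                                     ≡⟨ ξ-≢T-≢CT (take (2 + m) g) (≢alt false) (≢alt true) ⟩
  ξ-lr (take (2 + m) g)                                  ≡⟨ ξ-lr-take (suc m) g ⟩
  sgn (ξ (take (suc m) g) +ℤ ξ (take (suc m) (g ∘ suc))) ≡⟨ cong₂ (λ x y → sgn (x +ℤ y))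
                                                              (ξ-take-const (suc m) b g const)
                                                              (ξ-take-const (suc m) b (g ∘ suc) (const ∘ suc)) ⟩
  0ℤ                                                     ∎
  where
  open ≡-Reasoning
  ≢alt : ∀ b′ → take (2 + m) g ≢ alt b′ (2 + m)
  ≢alt b′ = take-≢alt 0 b′ g (s≤s (s≤s z≤n)) (trans (const 0) (sym (const 1)))

Alternating : (ℕ → Bool) → Set
Alternating g = ∀ t → g (suc t) ≡ not (g t)

take-alternating : ∀ m g → Alternating g → take m g ≡ alt (g 0) m
take-alternating zero g _ with g 0
... | false = refl
... | true = refl
take-alternating (suc m) g alternating = begin
  g 0 ∷ take m (g ∘ suc)     ≡⟨ cong (g 0 ∷_) (take-alternating m (g ∘ suc) (alternating ∘ suc)) ⟩
  g 0 ∷ alt (g 1) m          ≡⟨ cong (λ b → g 0 ∷ alt b m) (alternating 0) ⟩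
  g 0 ∷ alt (not (g 0)) m    ≡⟨ alt-suc (g 0) m ⟨
  alt (g 0) (suc m)          ∎
  where open ≡-Reasoning

ξ-take-alternating-even : ∀ p g → Alternating g → ξ (take (double (suc p)) g) ≡ (if g 0 then -1ℤ else 1ℤ)
ξ-take-alternating-even p g alternating =
  trans (cong ξ (take-alternating (double (suc p)) g alternating)) (ξ-alt-even (g 0) p)

ξ-take-alternating-odd : ∀ p g → Alternating g → ξ (take (suc (double p)) g) ≡ 0ℤ
ξ-take-alternating-odd zero g _ = refl
ξ-take-alternating-odd (suc p) g alternating = begin
  ξ (take (suc (double (suc p))) g)                                      ≡⟨ ξ-take-odd (suc p) g ⟩
  sgn (ξ (take (double (suc p)) g) +ℤ ξ (take (double (suc p)) (g ∘ suc)))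
    ≡⟨ cong₂ (λ x y → sgn (x +ℤ y)) (ξ-take-alternating-even p g alternating)
                                    (ξ-take-alternating-even p (g ∘ suc) (alternating ∘ suc)) ⟩
  sgn (sign (g 0) +ℤ sign (g 1))                                         ≡⟨ cong (λ b → sgn (sign (g 0) +ℤ sign b)) (alternating 0) ⟩
  sgn (sign (g 0) +ℤ sign (not (g 0)))                                   ≡⟨ cancel (g 0) ⟩
  0ℤ                                                                     ∎
  where
  open ≡-Reasoning
  sign : Bool → ℤ
  sign b = if b then -1ℤ else 1ℤ
  cancel : ∀ b → sgn (sign b +ℤ sign (not b)) ≡ 0ℤ
  cancel false = refl
  cancel true = refl

ξ-take-alternating : ∀ m g → Alternating g → ξ (take m g) ≡ 1ℤ → ξ (take m (g ∘ suc)) ≡ -1ℤ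
ξ-take-alternating m g alternating ξ≡1 with parity m
... | even zero = ⊥-elim (0≢1 ξ≡1)
... | odd p = ⊥-elim (0≢1 (trans (sym (ξ-take-alternating-odd p g alternating)) ξ≡1))
... | even (suc p) = trans (ξ-take-alternating-even p (g ∘ suc) (alternating ∘ suc))
                      (flip (g 0) (alternating 0) (trans (sym (ξ-take-alternating-even p g alternating)) ξ≡1))
  where
  flip : ∀ b {c} → c ≡ not b → (if b then -1ℤ else 1ℤ) ≡ 1ℤ → (if c then -1ℤ else 1ℤ) ≡ -1ℤ
  flip false refl _ = refl
  flip true _ ()

Periodic : ℕ → (ℕ → Bool) → Set
Periodic K g = ∀ x → g (K + x) ≡ g x

periodic-* : ∀ K g → Periodic K g → ∀ j x → g (j * K + x) ≡ g x
periodic-* K g periodic zero x = refl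
periodic-* K g periodic (suc j) x = begin
  g (K + j * K + x)   ≡⟨ cong g (+-assoc K (j * K) x) ⟩
  g (K + (j * K + x)) ≡⟨ periodic (j * K + x) ⟩
  g (j * K + x)       ≡⟨ periodic-* K g periodic j x ⟩
  g x                 ∎
  where open ≡-Reasoning

periodic-% : ∀ K .{{_ : NonZero K}} g → Periodic K g → ∀ t s → g (t + s) ≡ g (t + s % K)
periodic-% K g periodic t s = begin
  g (t + s)                       ≡⟨ cong (λ s → g (t + s)) (m≡m%n+[m/n]*n s K) ⟩
  g (t + (s % K + s / K * K))     ≡⟨ cong g (regroup t (s % K) (s / K * K)) ⟩
  g (s / K * K + (t + s % K))     ≡⟨ periodic-* K g periodic (s / K) (t + s % K) ⟩
  g (t + s % K)                   ∎
  where
  open ≡-Reasoning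
  regroup : ∀ t a b → t + (a + b) ≡ b + (t + a)
  regroup = solve-∀

drop-periodic : ∀ K g → Periodic K g → ∀ i → Periodic K (drop i g)
drop-periodic K g periodic i t = trans (cong g (regroup i K t)) (periodic (i + t))
  where
  regroup : ∀ i K t → i + (K + t) ≡ K + (i + t)
  regroup = solve-∀

take-drop-suc : ∀ n i g → take n (drop (suc i) g) ≡ take n (drop i g ∘ suc)
take-drop-suc n i g = tabulate-cong (λ t → cong g (sym (+-suc i (toℕ t))))

realign : ∀ k g → Periodic (suc k) g → ∀ q r → ∃ λ s → ∀ m → drop s g (m + r) ≡ g (m + q)
realign k g periodic q r = q + r * k , λ m → trans (cong g (regroup q r k m)) (periodic-* (suc k) g periodic r (m + q))
  where
  regroup : ∀ q r k m → q + r * k + (m + r) ≡ r * suc k + (m + q)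
  regroup = solve-∀

2-periodic-constant : ∀ g → Periodic 2 g → g 0 ≡ g 1 → ∀ t → g t ≡ g 0
2-periodic-constant g _ _ zero = refl
2-periodic-constant g _ g₀≡g₁ (suc zero) = sym g₀≡g₁
2-periodic-constant g periodic g₀≡g₁ (suc (suc t)) = trans (periodic t) (2-periodic-constant g periodic g₀≡g₁ t)

2-periodic-alternating : ∀ g → Periodic 2 g → g 0 ≢ g 1 → Alternating g
2-periodic-alternating g _ g₀≢g₁ zero = ¬-not (g₀≢g₁ ∘ sym)
2-periodic-alternating g periodic g₀≢g₁ (suc t) = begin
  g (2 + t)             ≡⟨ periodic t ⟩
  g t                   ≡⟨ not-involutive (g t) ⟨
  not (not (g t))       ≡⟨ cong not (2-periodic-alternating g periodic g₀≢g₁ t) ⟨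
  not (g (suc t))       ∎
  where open ≡-Reasoning

ξ-take-2-periodic : ∀ m g → Periodic 2 g → ξ (take m g) ≡ 1ℤ → ξ (take m (g ∘ suc)) ≡ -1ℤ
ξ-take-2-periodic m g periodic ξ≡1 with g 0 ≟𝔹 g 1
... | yes g₀≡g₁ = ⊥-elim (0≢1 (trans (sym (ξ-take-const m (g 0) g (2-periodic-constant g periodic g₀≡g₁))) ξ≡1))
... | no g₀≢g₁ = ξ-take-alternating m g (2-periodic-alternating g periodic g₀≢g₁) ξ≡1

negative-windows-at-1?0 : ∀ k g → Periodic (suc k) g → ∀ q → g q ≡ true → g (2 + q) ≡ false → ∀ p →
  (∃ λ s → ξ (take (double (suc p)) (drop s g)) ≡ -1ℤ) × (∃ λ s → ξ (take (suc (double (suc p))) (drop s g)) ≡ -1ℤ)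
negative-windows-at-1?0 k g periodic q g₀ g₂ p with g (suc q) in g₁
... | true = even-length p , odd-length
  where
  even-length : ∀ p → ∃ λ s → ξ (take (double (suc p)) (drop s g)) ≡ -1ℤ
  even-length zero with realign k g periodic (suc q) 0
  ... | s , agree = s , ξ-take-10 (drop s g) (trans (agree 0) g₁) (trans (agree 1) g₂)
  even-length (suc p) with realign k g periodic q p
  ... | s , agree = s , proj₂ (ξ-take-110 p (drop s g) (trans (agree 0) g₀) (trans (agree 1) g₁) (trans (agree 2) g₂))
  odd-length : ∃ λ s → ξ (take (suc (double (suc p))) (drop s g)) ≡ -1ℤ
  odd-length with realign k g periodic q p
  ... | s , agree = s , proj₁ (ξ-take-110 p (drop s g) (trans (agree 0) g₀) (trans (agree 1) g₁) (trans (agree 2) g₂))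
... | false with realign k g periodic q p
...   | s , agree = (s , proj₁ 100-at-p) , (s , proj₂ 100-at-p)
  where
  100-at-p = ξ-take-100 p (drop s g) (trans (agree 0) g₀) (trans (agree 1) g₁) (trans (agree 2) g₂)

Avoids1?0 : (ℕ → Bool) → Set
Avoids1?0 g = ∀ x → g x ≡ true → g (2 + x) ≡ true

avoids1?0-iterate : ∀ g → Avoids1?0 g → ∀ {y} → g y ≡ true → ∀ j → g (double j + y) ≡ true
avoids1?0-iterate g avoids gy zero = gy
avoids1?0-iterate g avoids gy (suc j) = avoids _ (avoids1?0-iterate g avoids gy j)

-- Going 2k+2 steps up from 2 + x lands on x again modulo the period k+1.
periodic-avoids1?0-backward : ∀ k g → Periodic (suc k) g → Avoids1?0 g → ∀ x → g (2 + x) ≡ true → g x ≡ true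
periodic-avoids1?0-backward k g periodic avoids x g₂ₓ = begin
  g x                       ≡⟨ periodic x ⟨
  g (suc k + x)             ≡⟨ periodic (suc k + x) ⟨
  g (suc k + (suc k + x))   ≡⟨ cong g (regroup k x) ⟨
  g (double k + (2 + x))    ≡⟨ avoids1?0-iterate g avoids g₂ₓ k ⟩
  true                      ∎
  where
  open ≡-Reasoning
  regroup′ : ∀ k x → k + k + (2 + x) ≡ suc k + (suc k + x)
  regroup′ = solve-∀
  regroup : ∀ k x → double k + (2 + x) ≡ suc k + (suc k + x)
  regroup k x = trans (cong (_+ (2 + x)) (double≡+ k)) (regroup′ k x)

periodic-avoids1?0⇒2-periodic : ∀ k g → Periodic (suc k) g → Avoids1?0 g → Periodic 2 g
periodic-avoids1?0⇒2-periodic k g periodic avoids x with g x in gₓ | g (2 + x) in g₂ₓ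
... | true | true = refl
... | false | false = refl
... | true | false with () ← trans (sym g₂ₓ) (avoids x gₓ)
... | false | true with () ← trans (sym gₓ) (periodic-avoids1?0-backward k g periodic avoids x g₂ₓ)

negative-window : ∀ k g → Periodic (suc k) g → ∀ n i → ξ (take n (drop i g)) ≡ 1ℤ → ∃ λ s → ξ (take n (drop s g)) ≡ -1ℤ
negative-window k g periodic n i ξ≡1 with any? (λ (q : Fin (suc k)) → (g (toℕ q) ≟𝔹 true) ×-dec (g (2 + toℕ q) ≟𝔹 false))
... | yes (q , g₀ , g₂) with parity n
...   | even zero = ⊥-elim (0≢1 ξ≡1)
...   | odd zero = ⊥-elim (0≢1 ξ≡1)
...   | even (suc p) = proj₁ (negative-windows-at-1?0 k g periodic (toℕ q) g₀ g₂ p)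
...   | odd (suc p) = proj₂ (negative-windows-at-1?0 k g periodic (toℕ q) g₀ g₂ p)
negative-window k g periodic n i ξ≡1 | no no1?0 = suc i ,
  trans (cong ξ (take-drop-suc n i g)) (ξ-take-2-periodic n (drop i g) (drop-periodic 2 g 2-periodic i) ξ≡1)
  where
  avoids : Avoids1?0 g
  avoids x gₓ with g (2 + x) in g₂ₓ
  ... | true = refl
  ... | false = ⊥-elim (no1?0 (fromℕ< (m%n<n x (suc k)) , trans (reduce 0) gₓ , trans (reduce 2) g₂ₓ))
    where
    reduce : ∀ t → g (t + toℕ (fromℕ< (m%n<n x (suc k)))) ≡ g (t + x)
    reduce t = trans (cong (λ y → g (t + y)) (toℕ-fromℕ< _)) (sym (periodic-% (suc k) g periodic t x))
  2-periodic : Periodic 2 g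
  2-periodic = periodic-avoids1?0⇒2-periodic k g periodic avoids

at : Vec Bool m → ℕ → Bool
at [] _ = false
at (b ∷ _) zero = b
at (_ ∷ v) (suc x) = at v x

at-toℕ : (v : Vec Bool m) (i : Fin m) → at v (toℕ i) ≡ lookup v i
at-toℕ (b ∷ v) zero = refl
at-toℕ (b ∷ v) (suc i) = at-toℕ v i

lookup-fromℕ< : (v : Vec Bool m) {x : ℕ} (x<m : x < m) → lookup v (fromℕ< x<m) ≡ at v x
lookup-fromℕ< v x<m = trans (sym (at-toℕ v _)) (cong (at v) (toℕ-fromℕ< x<m))

periodic-within : ∀ {A : Set} K n (u : ℕ → A) → (∀ t → t < n → u (K + t) ≡ u t) →
  ∀ j r → j * K + r < K + n → u (j * K + r) ≡ u r
periodic-within K n u period zero r _ = refl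
periodic-within K n u period (suc j) r bound = begin
  u (K + j * K + r)   ≡⟨ cong u (+-assoc K (j * K) r) ⟩
  u (K + (j * K + r)) ≡⟨ period (j * K + r) t<n ⟩
  u (j * K + r)       ≡⟨ periodic-within K n u period j r (≤-trans t<n (m≤n+m n K)) ⟩
  u r                 ∎
  where
  open ≡-Reasoning
  t<n : j * K + r < n
  t<n = +-cancelˡ-< K _ _ (subst (_< K + n) (+-assoc K (j * K) r) bound)

module PeriodicExtension (k n : ℕ) (w : Vec Bool (suc k + n)) (prefix≡suffix : prefix {suc k} {n} w ≡ suffix w) where

  K : ℕ
  K = suc k

  f : ℕ → Bool
  f x = at w (x % K)

  f-periodic : Periodic K f
  f-periodic x = cong (at w) (trans (cong (_% K) (+-comm K x)) ([m+n]%n≡m%n x K))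

  w-periodic : ∀ t → t < n → at w (K + t) ≡ at w t
  w-periodic t t<n = begin
    at w (K + t)                 ≡⟨ cong (λ y → at w (K + y)) (toℕ-fromℕ< t<n) ⟨
    at w (K + toℕ t′)            ≡⟨ cong (at w) (toℕ-↑ʳ K t′) ⟨
    at w (toℕ (K ↑ʳ t′))         ≡⟨ at-toℕ w (K ↑ʳ t′) ⟩
    lookup w (K ↑ʳ t′)           ≡⟨ lookup∘tabulate _ t′ ⟨
    lookup (suffix w) t′         ≡⟨ cong (λ v → lookup v t′) prefix≡suffix ⟨
    lookup (prefix {K} w) t′     ≡⟨ trans (lookup∘tabulate _ t′) (lookup-fromℕ< w (≤-trans (toℕ<n t′) (m≤n+m n K))) ⟩
    at w (toℕ t′)                ≡⟨ cong (at w) (toℕ-fromℕ< t<n) ⟩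
    at w t                       ∎
    where
    open ≡-Reasoning
    t′ = fromℕ< t<n

  at≡f : ∀ x → x < K + n → at w x ≡ f x
  at≡f x x<K+n = trans (cong (at w) x≡) (periodic-within K n (at w) w-periodic (x / K) (x % K) (subst (_< K + n) x≡ x<K+n))
    where
    x≡ : x ≡ x / K * K + x % K
    x≡ = trans (m≡m%n+[m/n]*n x K) (+-comm (x % K) _)

  slice≡window : ∀ j → slice w j ≡ take n (drop (toℕ j) f)
  slice≡window j = tabulate-cong (λ t → trans (lookup-fromℕ< w (bound t)) (at≡f _ (bound t)))
    where
    bound : ∀ t → toℕ j + toℕ t < K + n
    bound t = +-mono-< (toℕ<n j) (toℕ<n t)

  window≡slice : ∀ s → take n (drop s f) ≡ slice w (fromℕ< (m%n<n s K))
  window≡slice s = begin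
    take n (drop s f)                          ≡⟨ tabulate-cong (λ t → reduce (toℕ t)) ⟩
    take n (drop (s % K) f)                    ≡⟨ cong (λ r → take n (drop r f)) (toℕ-fromℕ< (m%n<n s K)) ⟨
    take n (drop (toℕ (fromℕ< (m%n<n s K))) f) ≡⟨ slice≡window _ ⟨
    slice w (fromℕ< (m%n<n s K))               ∎
    where
    open ≡-Reasoning
    reduce : ∀ t → f (s + t) ≡ f (s % K + t)
    reduce t = trans (cong f (+-comm s t)) (trans (periodic-% K f f-periodic t s) (cong f (+-comm t (s % K))))

theorem2p17 : (k n : ℕ) (w : Vec Bool (k + n)) →
    prefix {k} {n} w ≡ suffix {k} {n} w →
    ∃ (λ (i : Fin k) → ξ (slice {k} {n} w i) ≡ 1ℤ) →
    ∃ (λ (j : Fin k) → ξ (slice {k} {n} w j) ≡ -1ℤ)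
theorem2p17 zero n w _ (() , _)
theorem2p17 (suc k) n w prefix≡suffix (i , ξ≡1) =
  let s , ξ≡-1 = negative-window k f f-periodic n (toℕ i) (trans (cong ξ (sym (slice≡window i))) ξ≡1)
  in fromℕ< (m%n<n s (suc k)) , trans (cong ξ (sym (window≡slice s))) ξ≡-1
  where open PeriodicExtension k n w prefix≡suffix
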